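{- For every real number $c>0$ there exists a finite weighted graph $G=(V(G),E(G),w)$ with $w:E(G)\to\mathbb{R}_{\ge 0}$ such that every bipartition $(X,Y)$ of $V(G)$ into two non-empty parts satisfies $w(X,Y)<\frac{w(G)}{2}+c\cdot\Delta_w(G)$.
   Context: $w(G)$ is the total weight of the edges of $G$, $w(X,Y)$ is the total weight of edges with one endpoint in $X$ and the other in $Y$, and $\Delta_w(G)=\max_v\sum_{u\in N(v)}w(vu)$ is the maximum weighted degree.
   Formalization: The constant c ranges over the positive rationals rather than the positive reals, and the edge weights are taken in the rationals. -}

module Defs where

open import Data.Bool using (Bool; true; false; if_then_else_)
open import Data.Nat using (ℕ)
import Data.Nat as ℕ
open import Data.Fin using (Fin; toℕ)
open import Data.List using (List; map; foldr; allFin)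
open import Data.Rational using (ℚ; 0ℚ; _+_; _*_; _⊔_; _≤_; ½)
open import Relation.Binary.PropositionalEquality using (_≡_)

-- A finite weighted (simple) graph on the vertex set Fin n:
-- adjacency relation (symmetric, irreflexive) and a nonnegative
-- symmetric weight w, of which only the values on edges matter.
record WeightedGraph : Set where
  field
    n      : ℕ
    adj    : Fin n → Fin n → Bool
    adj-sym   : ∀ u v → adj u v ≡ adj v u
    adj-irrefl : ∀ v → adj v v ≡ false
    w      : Fin n → Fin n → ℚ
    w-sym  : ∀ u v → w u v ≡ w v u
    w-nonneg : ∀ u v → adj u v ≡ true → 0ℚ ≤ w u v

open WeightedGraph public

Σv : (k : ℕ) → (Fin k → ℚ) → ℚ
Σv k f = foldr _+_ 0ℚ (map f (allFin k))

ew : (G : WeightedGraph) → Fin (n G) → Fin (n G) → ℚ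
ew G u v = if adj G u v then w G u v else 0ℚ

totalWeight : WeightedGraph → ℚ
totalWeight G = Σv (n G) λ u → Σv (n G) λ v →
  if toℕ u ℕ.<ᵇ toℕ v then ew G u v else 0ℚ

wdeg : (G : WeightedGraph) → Fin (n G) → ℚ
wdeg G v = Σv (n G) λ u → ew G v u

maxWDeg : WeightedGraph → ℚ
maxWDeg G = foldr _⊔_ 0ℚ (map (wdeg G) (allFin (n G)))

-- w(X,Y) for the bipartition X = {v | S v ≡ true}, Y = {v | S v ≡ false}
cutWeight : (G : WeightedGraph) → (Fin (n G) → Bool) → ℚ
cutWeight G S = Σv (n G) λ u → Σv (n G) λ v →
  if S u then (if S v then 0ℚ else ew G u v) else 0ℚ

module Submission where

-- The witness is a hub graph: a hub joined by edges of weight m to each of k = m² leaves, any two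
-- leaves joined by an edge of weight 1. Then w(G) = km + k(k-1)/2 and the hub has weighted degree
-- km ≤ Δ_w(G). If the hub lies in X together with a leaves and the other b = k - a leaves lie in Y,
-- then w(X,Y) = b(m + a) ≤ (k + m)²/4 = (2w(G) + k + m²)/4 by AM-GM. Since k = m² this is
-- w(G)/2 + k/2 < w(G)/2 + k ≤ w(G)/2 + c·Δ_w(G) as soon as c·m ≥ 1.

open import Defs
open import Data.Bool using (Bool; true; false; not; if_then_else_; T)
open import Data.Fin using (Fin; zero; suc; toℕ)
open import Data.Nat using (ℕ; zero; suc)
import Data.Nat as ℕ
import Data.Nat.Properties as ℕP
open import Data.Product using (Σ; ∃; _×_; _,_)
open import Function using (_∘_; id; case_of_)
open import Relation.Binary.PropositionalEquality
open import Algebra.Properties.Semiring.Sum ℕP.+-*-semiring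
  using (sum; sum-syntax; sum-cong-≗; ∑-distrib-+; *-distribˡ-sum; *-distribʳ-sum)

module Counting where
  open import Data.Nat using (_+_; _*_; _∸_; _≤_; _<ᵇ_)
  open import Data.Nat.Properties
  open import Data.Sum using (inj₁; inj₂)
  open import Data.Nat.Tactic.RingSolver using (solve-∀; solve)
  open import Data.List using ([]; _∷_)

  4*m*[m+d]≤[m+[m+d]]² : ∀ m d → 4 * (m * (m + d)) ≤ (m + (m + d)) * (m + (m + d))
  4*m*[m+d]≤[m+[m+d]]² m d = subst (4 * (m * (m + d)) ≤_) (square m d) (m≤m+n _ (d * d))
    where
    square : ∀ m d → 4 * (m * (m + d)) + d * d ≡ (m + (m + d)) * (m + (m + d))
    square = solve-∀

  4*m*n≤[m+n]² : ∀ m n → 4 * (m * n) ≤ (m + n) * (m + n)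
  4*m*n≤[m+n]² m n with ≤-total m n
  ... | inj₁ m≤n = subst (λ n → 4 * (m * n) ≤ (m + n) * (m + n)) (m+[n∸m]≡n m≤n)
                     (4*m*[m+d]≤[m+[m+d]]² m (n ∸ m))
  ... | inj₂ n≤m = subst₂ _≤_ (cong (4 *_) (*-comm n m)) (cong (λ s → s * s) (+-comm n m))
                     (subst (λ m → 4 * (n * m) ≤ (n + m) * (n + m)) (m+[n∸m]≡n n≤m)
                       (4*m*[m+d]≤[m+[m+d]]² n (m ∸ n)))

  𝟙 : Bool → ℕ
  𝟙 b = if b then 1 else 0

  count : ∀ {k} → (Fin k → Bool) → ℕ
  count P = sum (𝟙 ∘ P)

  sum-const : ∀ k c → sum {k} (λ _ → c) ≡ k * c
  sum-const zero    c = refl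
  sum-const (suc k) c = cong (c +_) (sum-const k c)

  count+count-not : ∀ {k} (P : Fin k → Bool) → count P + count (not ∘ P) ≡ k
  count+count-not {k} P = begin
    count P + count (not ∘ P)           ≡⟨ ∑-distrib-+ (𝟙 ∘ P) (𝟙 ∘ not ∘ P) ⟨
    sum (λ i → 𝟙 (P i) + 𝟙 (not (P i))) ≡⟨ sum-cong-≗ (𝟙+𝟙-not ∘ P) ⟩
    sum {k} (λ _ → 1)                   ≡⟨ sum-const k 1 ⟩
    k * 1                               ≡⟨ *-identityʳ k ⟩
    k                                   ∎
    where
    open ≡-Reasoning
    𝟙+𝟙-not : ∀ b → 𝟙 b + 𝟙 (not b) ≡ 1
    𝟙+𝟙-not true  = refl
    𝟙+𝟙-not false = refl

  pairs : ℕ → ℕ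
  pairs k = ∑[ i < k ] ∑[ j < k ] 𝟙 (toℕ i <ᵇ toℕ j)

  2*pairs+k≡k*k : ∀ k → 2 * pairs k + k ≡ k * k
  2*pairs+k≡k*k zero    = refl
  2*pairs+k≡k*k (suc k) = begin
    2 * pairs (suc k) + suc k       ≡⟨ cong (λ p → 2 * (p + pairs k) + suc k) row-zero ⟩
    2 * (k + pairs k) + suc k       ≡⟨ regroup k (pairs k) ⟩
    (2 * pairs k + k) + suc (2 * k) ≡⟨ cong (_+ suc (2 * k)) (2*pairs+k≡k*k k) ⟩
    k * k + suc (2 * k)             ≡⟨ solve (k ∷ []) ⟩
    suc k * suc k                   ∎
    where
    open ≡-Reasoning
    row-zero : sum {k} (λ _ → 1) ≡ k
    row-zero = trans (sum-const k 1) (*-identityʳ k)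
    regroup : ∀ k p → 2 * (k + p) + suc k ≡ (2 * p + k) + suc (2 * k)
    regroup = solve-∀

  4*x*[m+y]≤[x+y+m]² : ∀ m x y → 4 * (x * (m + y)) ≤ (x + y + m) * (x + y + m)
  4*x*[m+y]≤[x+y+m]² m x y =
    subst (λ s → 4 * (x * (m + y)) ≤ s * s) (regroup m x y) (4*m*n≤[m+n]² x (m + y))
    where
    regroup : ∀ m x y → x + (m + y) ≡ x + y + m
    regroup = solve-∀

  module Hub (m k : ℕ) where

    -- Vertex zero is the hub. The value on the diagonal is junk: the graph has no loops,
    -- and in cut the factor 𝟙 (S u) * 𝟙 (not (S u)) kills it.
    weight : Fin (suc k) → Fin (suc k) → ℕ
    weight zero    _       = m
    weight (suc _) zero    = m
    weight (suc _) (suc _) = 1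

    weight-sym : ∀ u v → weight u v ≡ weight v u
    weight-sym zero    zero    = refl
    weight-sym zero    (suc _) = refl
    weight-sym (suc _) zero    = refl
    weight-sym (suc _) (suc _) = refl

    cut : (Fin (suc k) → Bool) → ℕ
    cut S = ∑[ u < suc k ] ∑[ v < suc k ] (𝟙 (S u) * (𝟙 (not (S v)) * weight u v))

    total : ℕ
    total = ∑[ u < suc k ] ∑[ v < suc k ] (if toℕ u <ᵇ toℕ v then weight u v else 0)

    total≡k*m+pairs : total ≡ k * m + pairs k
    total≡k*m+pairs = cong (_+ pairs k) (sum-const k m)

    module _ (S : Fin (suc k) → Bool) where

      leavesX leavesY : ℕ
      leavesX = count (S ∘ suc)
      leavesY = count (not ∘ S ∘ suc)

      cut≡ : cut S ≡ (if S zero then leavesY * (m + leavesX) else leavesX * (m + leavesY))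
      cut≡ = begin
        cut S
          ≡⟨ sum-cong-≗ (λ u → *-distribˡ-sum (𝟙 (S u)) (λ v → 𝟙 (not (S v)) * weight u v)) ⟨
        ∑[ u < suc k ] (𝟙 (S u) * toY u)
          ≡⟨ cong₂ (λ p q → 𝟙 (S zero) * p + q) toY-hub
               (trans (sum-cong-≗ (λ i → cong (𝟙 (S (suc i)) *_) (toY-leaf i)))
                      (sym (*-distribʳ-sum _ (𝟙 ∘ S ∘ suc)))) ⟩
        𝟙 (S zero) * ((𝟙 (not (S zero)) + leavesY) * m) + leavesX * (𝟙 (not (S zero)) * m + leavesY)
          ≡⟨ by-hub-side (S zero) m leavesX leavesY ⟩
        (if S zero then leavesY * (m + leavesX) else leavesX * (m + leavesY)) ∎
        where
        open ≡-Reasoning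
        toY : Fin (suc k) → ℕ
        toY u = ∑[ v < suc k ] (𝟙 (not (S v)) * weight u v)

        toY-hub : toY zero ≡ (𝟙 (not (S zero)) + leavesY) * m
        toY-hub = sym (*-distribʳ-sum m (𝟙 ∘ not ∘ S))

        toY-leaf : ∀ i → toY (suc i) ≡ 𝟙 (not (S zero)) * m + leavesY
        toY-leaf i = cong (𝟙 (not (S zero)) * m +_)
                          (sum-cong-≗ (λ j → *-identityʳ (𝟙 (not (S (suc j))))))

        by-hub-side : ∀ s m x y → 𝟙 s * ((𝟙 (not s) + y) * m) + x * (𝟙 (not s) * m + y)
                                ≡ (if s then y * (m + x) else x * (m + y))
        by-hub-side true  = hub-in-X
          where
          hub-in-X : ∀ m x y → 1 * ((0 + y) * m) + x * (0 * m + y) ≡ y * (m + x)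
          hub-in-X = solve-∀
        by-hub-side false = hub-in-Y
          where
          hub-in-Y : ∀ m x y → 0 * ((1 + y) * m) + x * (1 * m + y) ≡ x * (m + y)
          hub-in-Y = solve-∀

      4*cut≤[k+m]² : 4 * cut S ≤ (k + m) * (k + m)
      4*cut≤[k+m]² = subst (λ c → 4 * c ≤ (k + m) * (k + m)) (sym cut≡) (bound (S zero))
        where
        split : leavesX + leavesY ≡ k
        split = count+count-not (S ∘ suc)

        bound : ∀ s → 4 * (if s then leavesY * (m + leavesX) else leavesX * (m + leavesY))
                      ≤ (k + m) * (k + m)
        bound true  = subst (λ n → 4 * (leavesY * (m + leavesX)) ≤ (n + m) * (n + m))
                        (trans (+-comm leavesY leavesX) split) (4*x*[m+y]≤[x+y+m]² m leavesY leavesX)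
        bound false = subst (λ n → 4 * (leavesX * (m + leavesY)) ≤ (n + m) * (n + m))
                        split (4*x*[m+y]≤[x+y+m]² m leavesX leavesY)

    4*cut≤2*total+k+m*m : ∀ S → 4 * cut S ≤ 2 * total + k + m * m
    4*cut≤2*total+k+m*m S = begin
      4 * cut S                              ≤⟨ 4*cut≤[k+m]² S ⟩
      (k + m) * (k + m)                      ≡⟨ expand k m ⟩
      k * k + 2 * (k * m) + m * m            ≡⟨ cong (λ q → q + 2 * (k * m) + m * m) (2*pairs+k≡k*k k) ⟨
      2 * pairs k + k + 2 * (k * m) + m * m  ≡⟨ regroup (pairs k) k m ⟩
      2 * (k * m + pairs k) + k + m * m      ≡⟨ cong (λ t → 2 * t + k + m * m) total≡k*m+pairs ⟨
      2 * total + k + m * m                  ∎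
      where
      open ≤-Reasoning
      expand : ∀ k m → (k + m) * (k + m) ≡ k * k + 2 * (k * m) + m * m
      expand = solve-∀
      regroup : ∀ p k m → 2 * p + k + 2 * (k * m) + m * m ≡ 2 * (k * m + p) + k + m * m
      regroup = solve-∀

  2*cut≤total+k : ∀ m S → let open Hub m (m * m) in 2 * cut S ≤ total + m * m
  2*cut≤total+k m S =
    *-cancelˡ-≤ 2 (subst₂ _≤_ (quadruple (cut S)) (double total (m * m)) (4*cut≤2*total+k+m*m S))
    where
    open Hub m (m * m)
    quadruple : ∀ c → 4 * c ≡ 2 * (2 * c)
    quadruple = solve-∀
    double : ∀ t k → 2 * t + k + k ≡ 2 * (t + k)
    double = solve-∀

open Counting

import Data.Rational as ℚ
open import Data.Rational using (ℚ; mkℚ; 0ℚ; 1ℚ; _<_; _≤_; _+_; _*_; _⊔_; ½; NonNegative; Positive; *≤*; *<*)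
open import Data.Rational.Literals using (fromℤ)
import Data.Rational.Properties as ℚP
open import Algebra.Bundles using (CommutativeMonoid)
open import Algebra.Properties.CommutativeSemigroup
  (CommutativeMonoid.commutativeSemigroup ℚP.*-1-commutativeMonoid) using (x∙yz≈y∙xz)
import Data.Rational.Unnormalised as ℚᵘ
import Data.Rational.Unnormalised.Properties as ℚᵘP
open import Data.Integer using (+_; +[1+_]; -[1+_]; +0; +≤+; +<+; 1ℤ)
import Data.Integer as ℤ
import Data.Integer.Properties as ℤP
open import Data.List using (_∷_; map; foldr; allFin; tabulate)
import Data.List.Properties as ListP
open import Data.List.Membership.Propositional using (_∈_)
open import Data.List.Membership.Propositional.Properties using (∈-map⁺; ∈-allFin)
open import Data.List.Relation.Unary.Any using (here; there)
open import Data.Fin.Properties using (_≟_)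
open import Relation.Nullary using (does; yes; no)
open import Relation.Nullary.Decidable using (dec-true; dec-false)
open import Data.Unit using (tt)

ι : ℕ → ℚ
ι n = fromℤ (+ n)

ι-+ : ∀ m n → ι (m ℕ.+ n) ≡ ι m + ι n
ι-+ m n = ℚP.toℚᵘ-injective
  (ℚᵘP.≃-trans (ℚᵘ.*≡* numerators) (ℚᵘP.≃-sym (ℚP.toℚᵘ-homo-+ (ι m) (ι n))))
  where
  numerators : + (m ℕ.+ n) ℤ.* 1ℤ ≡ (+ m ℤ.* 1ℤ ℤ.+ + n ℤ.* 1ℤ) ℤ.* 1ℤ
  numerators = begin
    + (m ℕ.+ n) ℤ.* 1ℤ                  ≡⟨ ℤP.*-identityʳ _ ⟩
    + (m ℕ.+ n)                         ≡⟨ ℤP.pos-+ m n ⟩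
    + m ℤ.+ + n                         ≡⟨ cong₂ ℤ._+_ (ℤP.*-identityʳ (+ m)) (ℤP.*-identityʳ (+ n)) ⟨
    + m ℤ.* 1ℤ ℤ.+ + n ℤ.* 1ℤ           ≡⟨ ℤP.*-identityʳ _ ⟨
    (+ m ℤ.* 1ℤ ℤ.+ + n ℤ.* 1ℤ) ℤ.* 1ℤ ∎
    where open ≡-Reasoning

ι-* : ∀ m n → ι (m ℕ.* n) ≡ ι m * ι n
ι-* m n = ℚP.toℚᵘ-injective
  (ℚᵘP.≃-trans (ℚᵘ.*≡* numerators) (ℚᵘP.≃-sym (ℚP.toℚᵘ-homo-* (ι m) (ι n))))
  where
  numerators : + (m ℕ.* n) ℤ.* 1ℤ ≡ (+ m ℤ.* + n) ℤ.* 1ℤ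
  numerators = cong (ℤ._* 1ℤ) (ℤP.pos-* m n)

ι-mono-≤ : ∀ {m n} → m ℕ.≤ n → ι m ≤ ι n
ι-mono-≤ m≤n = *≤* (ℤP.*-monoʳ-≤-nonNeg 1ℤ (+≤+ m≤n))

½*ι[2*n]≡ι[n] : ∀ n → ½ * ι (2 ℕ.* n) ≡ ι n
½*ι[2*n]≡ι[n] n = begin
  ½ * ι (2 ℕ.* n) ≡⟨ cong (½ *_) (ι-* 2 n) ⟩
  ½ * (ι 2 * ι n) ≡⟨ ℚP.*-assoc ½ (ι 2) (ι n) ⟨
  1ℚ * ι n        ≡⟨ ℚP.*-identityˡ (ι n) ⟩
  ι n             ∎
  where open ≡-Reasoning

½*p<p : ∀ p .{{_ : Positive p}} → ½ * p < p
½*p<p p = subst (½ * p <_) (ℚP.*-identityˡ p) (ℚP.*-monoˡ-<-pos p ½<1)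
  where
  ½<1 : ½ < 1ℚ
  ½<1 = *<* (+<+ (ℕ.s≤s (ℕ.s≤s ℕ.z≤n)))

archimedean : ∀ c → 0ℚ < c → ∃ λ m → 1ℚ ≤ c * ι (suc m)
archimedean c@(mkℚ +[1+ p ] d _) _ = d , subst (1ℚ ≤_) numerator≡c*denominator (ι-mono-≤ (ℕ.s≤s ℕ.z≤n))
  where
  numerator≡c*denominator : ι (suc p) ≡ c * ι (suc d)
  numerator≡c*denominator = ℚP.toℚᵘ-injective (ℚᵘP.≃-sym (ℚᵘP.≃-trans
    (ℚP.toℚᵘ-homo-* c (ι (suc d))) (ℚᵘ.*≡* (ℤP.*-assoc +[1+ p ] (+ suc d) 1ℤ))))
archimedean (mkℚ +0       _ _) (*<* (+<+ ()))
archimedean (mkℚ -[1+ _ ] _ _) (*<* ())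

Σv-ι : ∀ {k} {f : Fin k → ℚ} (g : Fin k → ℕ) → (∀ i → f i ≡ ι (g i)) → Σv k f ≡ ι (sum g)
Σv-ι {k} {f} g f≗ιg = begin
  foldr _+_ 0ℚ (map f (allFin k))       ≡⟨ cong (foldr _+_ 0ℚ) (ListP.map-cong f≗ιg (allFin k)) ⟩
  foldr _+_ 0ℚ (map (ι ∘ g) (allFin k)) ≡⟨ cong (foldr _+_ 0ℚ) (ListP.map-tabulate id (ι ∘ g)) ⟩
  foldr _+_ 0ℚ (tabulate (ι ∘ g))       ≡⟨ foldr-tabulate g ⟩
  ι (sum g)                             ∎
  where
  open ≡-Reasoning
  foldr-tabulate : ∀ {k} (g : Fin k → ℕ) → foldr _+_ 0ℚ (tabulate (ι ∘ g)) ≡ ι (sum g)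
  foldr-tabulate {zero}  g = refl
  foldr-tabulate {suc k} g =
    trans (cong (_+_ (ι (g zero))) (foldr-tabulate (g ∘ suc))) (sym (ι-+ (g zero) (sum (g ∘ suc))))

∈⇒≤foldr-⊔ : ∀ {p xs} → p ∈ xs → p ≤ foldr _⊔_ 0ℚ xs
∈⇒≤foldr-⊔ {xs = q ∷ _} (here refl) = ℚP.p≤p⊔q q _
∈⇒≤foldr-⊔ {xs = q ∷ _} (there p∈xs) = ℚP.≤-trans (∈⇒≤foldr-⊔ p∈xs) (ℚP.p≤q⊔p q _)

wdeg≤maxWDeg : ∀ G v → wdeg G v ≤ maxWDeg G
wdeg≤maxWDeg G v = ∈⇒≤foldr-⊔ (∈-map⁺ (wdeg G) (∈-allFin v))

distinct : ∀ {k} → Fin k → Fin k → Bool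
distinct u v = not (does (u ≟ v))

distinct-sym : ∀ {k} (u v : Fin k) → distinct u v ≡ distinct v u
distinct-sym u v with u ≟ v
... | yes u≡v = cong not (sym (dec-true (v ≟ u) (sym u≡v)))
... | no  u≢v = cong not (sym (dec-false (v ≟ u) (u≢v ∘ sym)))

distinct-irrefl : ∀ {k} (v : Fin k) → distinct v v ≡ false
distinct-irrefl v = cong not (dec-true (v ≟ v) refl)

distinct-≢ : ∀ {k} {u v : Fin k} → u ≢ v → distinct u v ≡ true
distinct-≢ {u = u} {v} u≢v = cong not (dec-false (u ≟ v) u≢v)

hubGraph : ℕ → ℕ → WeightedGraph
hubGraph m k = record
  { n          = suc k
  ; adj        = distinct
  ; adj-sym    = distinct-sym
  ; adj-irrefl = distinct-irrefl
  ; w          = λ u v → ι (weight u v)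
  ; w-sym      = λ u v → cong ι (weight-sym u v)
  ; w-nonneg   = λ _ _ _ → ι-mono-≤ ℕ.z≤n
  }
  where open Hub m k

module _ (m k : ℕ) where
  open Hub m k

  ew-hubGraph : ∀ {u v} → u ≢ v → ew (hubGraph m k) u v ≡ ι (weight u v)
  ew-hubGraph {u} {v} u≢v = cong (λ b → if b then ι (weight u v) else 0ℚ) (distinct-≢ u≢v)

  cutWeight-hubGraph : ∀ S → cutWeight (hubGraph m k) S ≡ ι (cut S)
  cutWeight-hubGraph S = Σv-ι _ λ u → Σv-ι _ λ v → summand u v
    where
    summand : ∀ u v → (if S u then (if S v then 0ℚ else ew (hubGraph m k) u v) else 0ℚ)
                      ≡ ι (𝟙 (S u) ℕ.* (𝟙 (not (S v)) ℕ.* weight u v))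
    summand u v with S u in Su | S v in Sv
    ... | false | _     = refl
    ... | true  | true  = refl
    ... | true  | false = trans (ew-hubGraph λ { refl → case trans (sym Su) Sv of λ () })
                                (cong ι (sym (trans (ℕP.*-identityˡ _) (ℕP.*-identityˡ _))))

  totalWeight-hubGraph : totalWeight (hubGraph m k) ≡ ι total
  totalWeight-hubGraph = Σv-ι _ λ u → Σv-ι _ λ v → summand u v
    where
    summand : ∀ u v → (if toℕ u ℕ.<ᵇ toℕ v then ew (hubGraph m k) u v else 0ℚ)
                      ≡ ι (if toℕ u ℕ.<ᵇ toℕ v then weight u v else 0)
    summand u v with toℕ u ℕ.<ᵇ toℕ v in u<v
    ... | false = refl
    ... | true  = ew-hubGraph λ { refl → ℕP.<-irrefl refl (ℕP.<ᵇ⇒< (toℕ u) (toℕ u) (subst T (sym u<v) tt)) }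

  wdeg-hub : wdeg (hubGraph m k) zero ≡ ι (k ℕ.* m)
  wdeg-hub = trans (Σv-ι {f = ew (hubGraph m k) zero} (λ { zero → 0 ; (suc _) → m })
                                                     (λ { zero → refl ; (suc _) → refl }))
                   (cong ι (sum-const k m))

hubGraph-cutWeight< : ∀ h c .{{_ : NonNegative c}} → 1ℚ ≤ c * ι (suc h) →
  let m = suc h ; G = hubGraph m (m ℕ.* m) in
  ∀ S → cutWeight G S < ½ * totalWeight G + c * maxWDeg G
hubGraph-cutWeight< h c 1≤c*m S = begin-strict
  cutWeight G S               ≡⟨ cutWeight-hubGraph m k S ⟩
  ι (cut S)                   ≡⟨ ½*ι[2*n]≡ι[n] (cut S) ⟨
  ½ * ι (2 ℕ.* cut S)         ≤⟨ ℚP.*-monoˡ-≤-nonNeg ½ (ι-mono-≤ (2*cut≤total+k m S)) ⟩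
  ½ * ι (total ℕ.+ k)         ≡⟨ trans (cong (½ *_) (ι-+ total k)) (ℚP.*-distribˡ-+ ½ (ι total) (ι k)) ⟩
  ½ * ι total + ½ * ι k       <⟨ ℚP.+-monoʳ-< (½ * ι total) (½*p<p (ι k)) ⟩
  ½ * ι total + ι k           ≤⟨ ℚP.+-monoʳ-≤ (½ * ι total) ι[k]≤cΔ ⟩
  ½ * ι total + c * maxWDeg G ≡⟨ cong (λ t → ½ * t + c * maxWDeg G) (totalWeight-hubGraph m k) ⟨
  ½ * totalWeight G + c * maxWDeg G ∎
  where
  m = suc h
  k = m ℕ.* m
  G = hubGraph m k
  open Hub m k
  open ℚP.≤-Reasoning

  ι[k]≤cΔ : ι k ≤ c * maxWDeg G
  ι[k]≤cΔ = begin
    ι k               ≡⟨ ℚP.*-identityʳ (ι k) ⟨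
    ι k * 1ℚ          ≤⟨ ℚP.*-monoˡ-≤-nonNeg (ι k) 1≤c*m ⟩
    ι k * (c * ι m)   ≡⟨ x∙yz≈y∙xz (ι k) c (ι m) ⟩
    c * (ι k * ι m)   ≡⟨ cong (c *_) (ι-* k m) ⟨
    c * ι (k ℕ.* m)   ≡⟨ cong (c *_) (wdeg-hub m k) ⟨
    c * wdeg G zero   ≤⟨ ℚP.*-monoˡ-≤-nonNeg c (wdeg≤maxWDeg G zero) ⟩
    c * maxWDeg G     ∎

-- The bound holds for every S, so the parts need not be non-empty.
proposition1 : (c : ℚ) → 0ℚ < c →
    Σ WeightedGraph λ G → (2 ℕ.≤ n G) ×
    ((S : Fin (n G) → Bool) → ∃ (λ x → S x ≡ true) → ∃ (λ y → S y ≡ false) →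
    cutWeight G S < ½ * totalWeight G + c * maxWDeg G)
proposition1 c 0<c =
  let h , 1≤c*m = archimedean c 0<c
      m = suc h
  in hubGraph m (m ℕ.* m) , ℕ.s≤s (ℕ.s≤s ℕ.z≤n) ,
     λ S _ _ → hubGraph-cutWeight< h c {{ℚ.nonNegative (ℚP.<⇒≤ 0<c)}} 1≤c*m S
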